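{- For all hypergraphs $G$ and $H$, the following are equivalent: (1) hypergraph color refinement does not distinguish $G$ and $H$; (2) color refinement does not distinguish the colored incidence graphs $C(G)$ and $C(H)$.
   Context: All structures are finite. A hypergraph is a triple $G=(V,E,f)$ with vertex set $V(G)$, edge set $E(G)$ and incidence function $f_G\colon E(G)\to\mathcal{P}(V(G))\setminus\{\emptyset\}$; parallel edges are allowed. The colored incidence graph $C(G)$ is the vertex-colored simple graph with vertex set $V(G)\,\dot\cup\, E(G)$, an edge $ve$ whenever $v\in f_G(e)$, where elements of $V(G)$ get color $1$ and elements of $E(G)$ get color $2$. Hypergraph color refinement: $c^G_0(v)=1$ for $v\in V(G)$ and $c^G_{i+1}(v)=\{\!\{\ \{\!\{ c^G_i(u) : u\in f_G(e)\}\!\}\ : e\in E(G),\ v\in f_G(e)\}\!\}$; it distinguishes $G,H$ if for some $i\ge0$ the multisets $\{\!\{c^G_i(v):v\in V(G)\}\!\}$ and $\{\!\{c^H_i(v):v\in V(H)\}\!\}$ differ. Color refinement on a vertex-colored graph $X$ with coloring $\lambda$: $\chi^X_0(x)=\lambda(x)$ and $\chi^X_{i+1}(x)=(\chi^X_i(x),\{\!\{\chi^X_i(y): y \text{ adjacent to } x\}\!\})$; it distinguishes $X$ and $Y$ if for some $i\ge 0$ the multisets $\{\!\{\chi^X_i(x):x\in V(X)\}\!\}$ and $\{\!\{\chi^Y_i(y):y\in V(Y)\}\!\}$ differ. -}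

module Defs where

open import Level using (0ℓ)
open import Data.Nat using (ℕ; zero; suc; _+_)
open import Data.Bool using (Bool; true; false; _≟_)
open import Data.Fin using (Fin; splitAt)
open import Data.Fin.Subset using (Subset; _∈_; Nonempty)
open import Data.Fin.Subset.Properties using (_∈?_)
open import Data.List using (List; map; filter; allFin)
open import Data.Product using (Σ; ∃; _×_; _,_)
open import Data.Product.Relation.Binary.Pointwise.NonDependent using (×-setoid)
open import Data.Sum using (_⊎_; inj₁; inj₂)
open import Relation.Nullary using (¬_; does)
open import Relation.Binary using (Setoid)
open import Relation.Binary.PropositionalEquality using (setoid)
import Data.List.Relation.Binary.Permutation.Setoid as Perm

MSet : Setoid 0ℓ 0ℓ → Setoid 0ℓ 0ℓ
MSet S = Perm.↭-setoid S

-- Finite hypergraph: V = Fin n, E = Fin m, incidence f : E → nonempty subsets of V.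
-- Parallel edges allowed (f need not be injective).
record Hypergraph : Set where
  field
    n   : ℕ
    m   : ℕ
    f   : Fin m → Subset n
    f≠∅ : ∀ e → Nonempty (f e)
open Hypergraph public

members : (G : Hypergraph) → Fin (m G) → List (Fin (n G))
members G e = filter (λ u → u ∈? f G e) (allFin (n G))

edgesAt : (G : Hypergraph) → Fin (n G) → List (Fin (m G))
edgesAt G v = filter (λ e → v ∈? f G e) (allFin (m G))

HCol : ℕ → Setoid 0ℓ 0ℓ
HCol zero    = setoid ℕ
HCol (suc i) = MSet (MSet (HCol i))

hcr : (G : Hypergraph) (i : ℕ) → Fin (n G) → Setoid.Carrier (HCol i)
hcr G zero    v = 1
hcr G (suc i) v = map (λ e → map (hcr G i) (members G e)) (edgesAt G v)

hcrHist : (G : Hypergraph) (i : ℕ) → Setoid.Carrier (MSet (HCol i))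
hcrHist G i = map (hcr G i) (allFin (n G))

HDistinguishes : Hypergraph → Hypergraph → Set
HDistinguishes G H = ∃ λ i → ¬ (Setoid._≈_ (MSet (HCol i)) (hcrHist G i) (hcrHist H i))

record ColGraph : Set where
  field
    N   : ℕ
    adj : Fin N → Fin N → Bool
    col : Fin N → ℕ
open ColGraph public

neighbours : (X : ColGraph) → Fin (N X) → List (Fin (N X))
neighbours X x = filter (λ y → adj X x y ≟ true) (allFin (N X))

GCol : ℕ → Setoid 0ℓ 0ℓ
GCol zero    = setoid ℕ
GCol (suc i) = ×-setoid (GCol i) (MSet (GCol i))

cr : (X : ColGraph) (i : ℕ) → Fin (N X) → Setoid.Carrier (GCol i)
cr X zero    x = col X x
cr X (suc i) x = cr X i x , map (cr X i) (neighbours X x)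

crHist : (X : ColGraph) (i : ℕ) → Setoid.Carrier (MSet (GCol i))
crHist X i = map (cr X i) (allFin (N X))

GDistinguishes : ColGraph → ColGraph → Set
GDistinguishes X Y = ∃ λ i → ¬ (Setoid._≈_ (MSet (GCol i)) (crHist X i) (crHist Y i))

-- Coloured incidence graph C(G): vertex set Fin (n + m), where the first n
-- elements are V(G) (colour 1) and the last m are E(G) (colour 2);
-- v ~ e iff v ∈ f(e).
incAdj : (G : Hypergraph) → Fin (n G) ⊎ Fin (m G) → Fin (n G) ⊎ Fin (m G) → Bool
incAdj G (inj₁ v) (inj₂ e) = does (v ∈? f G e)
incAdj G (inj₂ e) (inj₁ v) = does (v ∈? f G e)
incAdj G (inj₁ _) (inj₁ _) = false
incAdj G (inj₂ _) (inj₂ _) = false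

incCol : (G : Hypergraph) → Fin (n G) ⊎ Fin (m G) → ℕ
incCol G (inj₁ _) = 1
incCol G (inj₂ _) = 2

C : Hypergraph → ColGraph
C G = record
  { N   = n G + m G
  ; adj = λ x y → incAdj G (splitAt (n G) x) (splitAt (n G) y)
  ; col = λ x → incCol G (splitAt (n G) x)
  }

-- Two rounds of colour refinement on C(G), vertex → edge → vertex, do the work of one round of
-- hypergraph colour refinement: the round-2i colour of a vertex in C(G) and its round-i hypergraph
-- colour determine each other through maps that do not depend on G (toIncidence, fromIncidence).
-- Restricting the histogram of C(G) to elements of initial colour 1 therefore gives (2) ⇒ (1).
-- For (1) ⇒ (2) the histogram of C(G) also needs the multiset of edge colours, i.e. of the
-- multisets of member colours of the edges. Flattening the round-(i+1) hypergraph histogram lists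
-- each of these once per member of the edge; as edges are nonempty, the repetitions can be
-- cancelled. Agreement of C(G) and C(H) at round 2i then gives agreement at every round ≤ 2i.
module Submission where

open import Level using (0ℓ)
open import Algebra using (CommutativeMonoid)
open import Data.Bool using (Bool; true; false; if_then_else_)
open import Data.Bool.Properties using (_≟_)
open import Data.Fin using (Fin; _↑ˡ_; _↑ʳ_)
open import Data.Fin.Properties using (splitAt-↑ˡ; splitAt-↑ʳ)
open import Data.Fin.Subset.Properties using (_∈?_)
open import Data.List
  using (List; []; _∷_; _++_; [_]; map; concat; concatMap; filter; replicate; length; tabulate; allFin)
import Data.List.Properties as List
open import Data.List.Membership.Propositional using (lose)
open import Data.List.Membership.Propositional.Properties using (∈-allFin)
import Data.List.Membership.Setoid as Membership
open import Data.List.Membership.Setoid.Properties using (∈-∃++; ∈-concatMap⁺; ∈-concatMap⁻)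
import Data.List.Relation.Binary.Permutation.Setoid as Permutation
import Data.List.Relation.Binary.Permutation.Setoid.Properties as Permutationₚ
import Data.List.Relation.Binary.Pointwise as Pointwise
open import Data.List.Relation.Unary.All as All using (All; _∷_)
import Data.List.Relation.Unary.All.Properties as Allₚ
open import Data.List.Relation.Unary.Any as Any using (here; there)
import Data.Nat as ℕ
open import Data.Nat using (ℕ; zero; suc; _+_; _<_; _≤′_; ≤′-refl; ≤′-step)
open import Data.Nat.Properties using (z≤′n; s≤′s)
open import Data.Product using (∃₂; _×_; _,_; proj₁; proj₂)
open import Function using (_∘_; id)
open import Function.Bundles using (_⇔_; mk⇔)
open import Relation.Binary using (Setoid; _Preserves_⟶_)
open import Relation.Binary.PropositionalEquality
  using (_≡_; _≢_; refl; sym; trans; cong; cong₂; subst₂; module ≡-Reasoning)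
open import Relation.Nullary using (¬_; Dec; does)
open import Relation.Unary using (Decidable)

open import Defs

Eq : (S : Setoid 0ℓ 0ℓ) → Setoid.Carrier S → Setoid.Carrier S → Set
Eq = Setoid._≈_

syntax Eq S x y = x ≈[ S ] y

GColour : ℕ → Set
GColour k = Setoid.Carrier (GCol k)

HColour : ℕ → Set
HColour i = Setoid.Carrier (HCol i)

singletonIf : {A : Set} → Bool → A → List A
singletonIf b a = if b then [ a ] else []

module _ {X A : Set} {P : X → Set} (P? : Decidable P) where

  map-filter : (g : X → A) (xs : List X) →
               map g (filter P? xs) ≡ concatMap (λ x → singletonIf (does (P? x)) (g x)) xs
  map-filter g []       = refl
  map-filter g (x ∷ xs) with does (P? x)
  ... | true  = cong (g x ∷_) (map-filter g xs)
  ... | false = map-filter g xs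

  concatMap-singletonIf : (a : A) (xs : List X) →
                          concatMap (λ x → singletonIf (does (P? x)) a) xs ≡ replicate (length (filter P? xs)) a
  concatMap-singletonIf a []       = refl
  concatMap-singletonIf a (x ∷ xs) with does (P? x)
  ... | true  = cong (a ∷_) (concatMap-singletonIf a xs)
  ... | false = concatMap-singletonIf a xs

filter-map : {X Y : Set} {P : Y → Set} (P? : Decidable P) (h : X → Y) (xs : List X) →
             filter P? (map h xs) ≡ map h (filter (P? ∘ h) xs)
filter-map P? h []       = refl
filter-map P? h (x ∷ xs) with does (P? (h x))
... | true  = cong (h x ∷_) (filter-map P? h xs)
... | false = filter-map P? h xs

filter-does-cong : {X : Set} {P Q : X → Set} (P? : Decidable P) (Q? : Decidable Q) →
                   (∀ x → does (P? x) ≡ does (Q? x)) → ∀ xs → filter P? xs ≡ filter Q? xs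
filter-does-cong P? Q? eq []       = refl
filter-does-cong P? Q? eq (x ∷ xs) with does (P? x) | does (Q? x) | eq x
... | true  | .true  | refl = cong (x ∷_) (filter-does-cong P? Q? eq xs)
... | false | .false | refl = filter-does-cong P? Q? eq xs

does-≟-true : ∀ b → does (b ≟ true) ≡ b
does-≟-true true  = refl
does-≟-true false = refl

map∘map : {X Y Z : Set} {f : Y → Z} {g : X → Y} {h : X → Z} →
          (∀ x → f (g x) ≡ h x) → ∀ xs → map f (map g xs) ≡ map h xs
map∘map fg≡h xs = trans (sym (List.map-∘ xs)) (List.map-cong fg≡h xs)

tabulate-+ : ∀ a b {A : Set} (h : Fin (a + b) → A) →
             tabulate h ≡ tabulate (h ∘ (_↑ˡ b)) ++ tabulate (h ∘ (a ↑ʳ_))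
tabulate-+ zero    b h = refl
tabulate-+ (suc a) b h = cong (h Fin.zero ∷_) (tabulate-+ a b (h ∘ Fin.suc))

allFin-+ : ∀ a b → allFin (a + b) ≡ map (_↑ˡ b) (allFin a) ++ map (a ↑ʳ_) (allFin b)
allFin-+ a b = trans (tabulate-+ a b id)
  (cong₂ _++_ (sym (List.map-tabulate id (_↑ˡ b))) (sym (List.map-tabulate id (a ↑ʳ_))))

module Multiset (S : Setoid 0ℓ 0ℓ) where

  open Setoid S renaming (Carrier to A) using (_≈_)
  open Setoid S using () renaming (refl to ≈-refl; sym to ≈-sym)
  open Permutation S
  open Permutationₚ S
  open Membership S using (_∈_)
  open import Algebra.Properties.CommutativeSemigroup
    (CommutativeMonoid.commutativeSemigroup ++-commutativeMonoid) using (interchange)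

  map∘map-↭ : {X Y : Set} {f : Y → A} {g : X → Y} {h : X → A} →
              (∀ x → f (g x) ≈ h x) → ∀ xs → map f (map g xs) ↭ map h xs
  map∘map-↭ fg≈h []       = ↭-refl
  map∘map-↭ fg≈h (x ∷ xs) = prep (fg≈h x) (map∘map-↭ fg≈h xs)

  concat⁺ : concat Preserves Permutation._↭_ (MSet S) ⟶ _↭_
  concat⁺ = Permutationₚ.foldr-commMonoid (MSet S) ++-isCommutativeMonoid

  concatMap-distrib-++ : {Y : Set} (g h : Y → List A) (ys : List Y) →
                         concatMap (λ y → g y ++ h y) ys ↭ concatMap g ys ++ concatMap h ys
  concatMap-distrib-++ g h []       = ↭-refl
  concatMap-distrib-++ g h (y ∷ ys) =
    ↭-trans (++⁺ˡ (g y ++ h y) (concatMap-distrib-++ g h ys))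
            (interchange (g y) (h y) (concatMap g ys) (concatMap h ys))

  concatMap-comm : {X Y : Set} (F : X → Y → List A) (xs : List X) (ys : List Y) →
                   concatMap (λ x → concatMap (F x) ys) xs ↭ concatMap (λ y → concatMap (λ x → F x y) xs) ys
  concatMap-comm F []       ys = ↭-sym (↭-reflexive (concatMap-[] ys))
    where
    concatMap-[] : {Y : Set} (ys : List Y) → concatMap {B = A} (λ _ → []) ys ≡ []
    concatMap-[] []       = refl
    concatMap-[] (_ ∷ ys) = concatMap-[] ys
  concatMap-comm F (x ∷ xs) ys =
    ↭-trans (++⁺ˡ (concatMap (F x) ys) (concatMap-comm F xs ys))
            (↭-sym (concatMap-distrib-++ (F x) (λ y → concatMap (λ x′ → F x′ y) xs) ys))

  incidence-double-count : {X Y : Set} {R : X → Y → Set} (R? : ∀ x y → Dec (R x y))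
                           (g : Y → A) (xs : List X) (ys : List Y) →
                           concatMap (λ x → map g (filter (R? x) ys)) xs
                           ↭ concatMap (λ y → replicate (length (filter (λ x → R? x y) xs)) (g y)) ys
  incidence-double-count R? g xs ys = begin
    concatMap (λ x → map g (filter (R? x) ys)) xs
      ≡⟨ List.concatMap-cong (λ x → map-filter (R? x) g ys) xs ⟩
    concatMap (λ x → concatMap (λ y → singletonIf (does (R? x y)) (g y)) ys) xs
      ↭⟨ concatMap-comm (λ x y → singletonIf (does (R? x y)) (g y)) xs ys ⟩
    concatMap (λ y → concatMap (λ x → singletonIf (does (R? x y)) (g y)) xs) ys
      ≡⟨ List.concatMap-cong (λ y → concatMap-singletonIf (λ x → R? x y) (g y) xs) ys ⟩
    concatMap (λ y → replicate (length (filter (λ x → R? x y) xs)) (g y)) ys ∎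
    where open PermutationReasoning

  ++-cancelˡ : ∀ zs {xs ys} → zs ++ xs ↭ zs ++ ys → xs ↭ ys
  ++-cancelˡ []       p = p
  ++-cancelˡ (z ∷ zs) p = ++-cancelˡ zs (drop-∷ p)

  ∈⇒↭∷ : ∀ {x ys} → x ∈ ys → ∃₂ λ y zs → x ≈ y × ys ↭ y ∷ zs
  ∈⇒↭∷ x∈ys with us , vs , y , x≈y , ys≋ ← ∈-∃++ S x∈ys =
    y , us ++ vs , x≈y , ↭-trans (refl ys≋) (shift ≈-refl us vs)

  ∈-replicate⁺ : ∀ {n x} → 0 < n → x ∈ replicate n x
  ∈-replicate⁺ {suc n} _ = here ≈-refl

  ∈-replicate⁻ : ∀ n {x y} → x ∈ replicate n y → x ≈ y
  ∈-replicate⁻ (suc n) (here x≈y)  = x≈y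
  ∈-replicate⁻ (suc n) (there x∈) = ∈-replicate⁻ n x∈

  replicateEach : (A → ℕ) → List A → List A
  replicateEach w = concatMap (λ x → replicate (w x) x)

  module _ {w : A → ℕ} (w-cong : ∀ {x y} → x ≈ y → w x ≡ w y) where

    Positive : A → Set
    Positive x = 0 < w x

    Positive-resp : ∀ {x y} → x ≈ y → Positive x → Positive y
    Positive-resp x≈y rewrite w-cong x≈y = id

    replicate-cong : ∀ {x y} → x ≈ y → replicate (w x) x ↭ replicate (w y) y
    replicate-cong {x} {y} x≈y rewrite w-cong x≈y = refl (Pointwise.replicate⁺ x≈y (w y))

    replicateEach⁺ : ∀ {xs ys} → xs ↭ ys → replicateEach w xs ↭ replicateEach w ys
    replicateEach⁺ xs↭ys = concat⁺ (map⁺ (MSet S) replicate-cong xs↭ys)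

    ∈-replicateEach⁺ : ∀ {x} xs → Positive x → x ∈ replicateEach w (x ∷ xs)
    ∈-replicateEach⁺ xs 0<wx =
      ∈-concatMap⁺ S S {f = λ x → replicate (w x) x} {xs = _ ∷ xs} (here (∈-replicate⁺ 0<wx))

    ∈-replicateEach⁻ : ∀ {x} ys → x ∈ replicateEach w ys → x ∈ ys
    ∈-replicateEach⁻ ys x∈ = Any.map (λ {y} → ∈-replicate⁻ (w y)) (∈-concatMap⁻ S S {xs = ys} x∈)

    replicateEach-cancel : ∀ {xs ys} → All Positive xs → All Positive ys →
                           replicateEach w xs ↭ replicateEach w ys → xs ↭ ys
    replicateEach-cancel {[]} {[]} _ _ _ = ↭-refl
    replicateEach-cancel {[]} {y ∷ ys} _ (0<wy ∷ _) p
      with () ← ∈-resp-↭ (↭-sym p) (∈-replicateEach⁺ ys 0<wy)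
    replicateEach-cancel {x ∷ xs} {ys} (0<wx ∷ pos-xs) pos-ys p
      with y , zs , x≈y , ys↭y∷zs ← ∈⇒↭∷ (∈-replicateEach⁻ ys (∈-resp-↭ p (∈-replicateEach⁺ xs 0<wx)))
      = ↭-trans (prep x≈y xs↭zs) (↭-sym ys↭y∷zs)
      where
      xs↭zs : xs ↭ zs
      xs↭zs = replicateEach-cancel pos-xs (All.tail (All-resp-↭ Positive-resp ys↭y∷zs pos-ys))
        (++-cancelˡ (replicate (w x) x)
          (↭-trans p (↭-trans (replicateEach⁺ ys↭y∷zs) (++⁺ʳ _ (replicate-cong (≈-sym x≈y))))))

module _ (S T : Setoid 0ℓ 0ℓ) (g : Setoid.Carrier S → Setoid.Carrier T)
         (g-cong : ∀ {x y} → x ≈[ S ] y → g x ≈[ T ] g y) where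

  map⁺-via : {X Y : Set} {χ : X → Setoid.Carrier S} {χ′ : Y → Setoid.Carrier S}
             {ψ : X → Setoid.Carrier T} {ψ′ : Y → Setoid.Carrier T} →
             (∀ x → g (χ x) ≈[ T ] ψ x) → (∀ y → g (χ′ y) ≈[ T ] ψ′ y) →
             ∀ {xs ys} → map χ xs ≈[ MSet S ] map χ′ ys → map ψ xs ≈[ MSet T ] map ψ′ ys
  map⁺-via {χ = χ} {χ′} {ψ} {ψ′} gχ≈ψ gχ′≈ψ′ {xs} {ys} p = begin
    map ψ xs          ↭⟨ map∘map-↭ gχ≈ψ xs ⟨
    map g (map χ xs)  ↭⟨ Permutationₚ.map⁺ S T g-cong p ⟩
    map g (map χ′ ys) ↭⟨ map∘map-↭ gχ′≈ψ′ ys ⟩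
    map ψ′ ys         ∎
    where
    open Permutation T using (module PermutationReasoning)
    open PermutationReasoning
    open Multiset T using (map∘map-↭)

module _ (G : Hypergraph) where

  vertex : Fin (n G) → Fin (N (C G))
  vertex v = v ↑ˡ m G

  edge : Fin (m G) → Fin (N (C G))
  edge e = n G ↑ʳ e

  neighbours-split : ∀ x → neighbours (C G) x ≡
    map vertex (filter (λ u → adj (C G) x (vertex u) ≟ true) (allFin (n G))) ++
    map edge   (filter (λ e → adj (C G) x (edge e) ≟ true) (allFin (m G)))
  neighbours-split x = begin
    filter Adj? (allFin (n G + m G))
      ≡⟨ cong (filter Adj?) (allFin-+ (n G) (m G)) ⟩
    filter Adj? (map vertex (allFin (n G)) ++ map edge (allFin (m G)))
      ≡⟨ List.filter-++ Adj? (map vertex (allFin (n G))) (map edge (allFin (m G))) ⟩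
    filter Adj? (map vertex (allFin (n G))) ++ filter Adj? (map edge (allFin (m G)))
      ≡⟨ cong₂ _++_ (filter-map Adj? vertex (allFin (n G))) (filter-map Adj? edge (allFin (m G))) ⟩
    _ ∎
    where
    open ≡-Reasoning
    Adj? = λ y → adj (C G) x y ≟ true

  neighbours-vertex : ∀ v → neighbours (C G) (vertex v) ≡ map edge (edgesAt G v)
  neighbours-vertex v = trans (neighbours-split (vertex v))
    (cong₂ (λ us es → map vertex us ++ map edge es)
      (List.filter-none _ (All.universal not-adjacent (allFin (n G))))
      (filter-does-cong _ (λ e → v ∈? f G e) does-adjacent (allFin (m G))))
    where
    not-adjacent : ∀ u → adj (C G) (vertex v) (vertex u) ≢ true
    not-adjacent u rewrite splitAt-↑ˡ (n G) v (m G) | splitAt-↑ˡ (n G) u (m G) = λ ()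
    does-adjacent : ∀ e → does (adj (C G) (vertex v) (edge e) ≟ true) ≡ does (v ∈? f G e)
    does-adjacent e rewrite splitAt-↑ˡ (n G) v (m G) | splitAt-↑ʳ (n G) (m G) e =
      does-≟-true (does (v ∈? f G e))

  neighbours-edge : ∀ e → neighbours (C G) (edge e) ≡ map vertex (members G e)
  neighbours-edge e = trans (neighbours-split (edge e))
    (trans (cong₂ (λ us es → map vertex us ++ map edge es)
             (filter-does-cong _ (λ u → u ∈? f G e) does-adjacent (allFin (n G)))
             (List.filter-none _ (All.universal not-adjacent (allFin (m G)))))
           (List.++-identityʳ _))
    where
    not-adjacent : ∀ e′ → adj (C G) (edge e) (edge e′) ≢ true
    not-adjacent e′ rewrite splitAt-↑ʳ (n G) (m G) e | splitAt-↑ʳ (n G) (m G) e′ = λ ()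
    does-adjacent : ∀ u → does (adj (C G) (edge e) (vertex u) ≟ true) ≡ does (u ∈? f G e)
    does-adjacent u rewrite splitAt-↑ʳ (n G) (m G) e | splitAt-↑ˡ (n G) u (m G) =
      does-≟-true (does (u ∈? f G e))

  mutual
    crᵛ : ∀ k → Fin (n G) → GColour k
    crᵛ zero    v = 1
    crᵛ (suc k) v = crᵛ k v , map (crᵉ k) (edgesAt G v)

    crᵉ : ∀ k → Fin (m G) → GColour k
    crᵉ zero    e = 2
    crᵉ (suc k) e = crᵉ k e , map (crᵛ k) (members G e)

  mutual
    cr-vertex : ∀ k v → cr (C G) k (vertex v) ≡ crᵛ k v
    cr-vertex zero    v rewrite splitAt-↑ˡ (n G) v (m G) = refl
    cr-vertex (suc k) v = cong₂ _,_ (cr-vertex k v)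
      (trans (cong (map (cr (C G) k)) (neighbours-vertex v)) (map∘map (cr-edge k) (edgesAt G v)))

    cr-edge : ∀ k e → cr (C G) k (edge e) ≡ crᵉ k e
    cr-edge zero    e rewrite splitAt-↑ʳ (n G) (m G) e = refl
    cr-edge (suc k) e = cong₂ _,_ (cr-edge k e)
      (trans (cong (map (cr (C G) k)) (neighbours-edge e)) (map∘map (cr-vertex k) (members G e)))

  crHist-C : ∀ k → crHist (C G) k ≡ map (crᵛ k) (allFin (n G)) ++ map (crᵉ k) (allFin (m G))
  crHist-C k = trans (cong (map (cr (C G) k)) (allFin-+ (n G) (m G)))
    (trans (List.map-++ (cr (C G) k) (map vertex (allFin (n G))) (map edge (allFin (m G))))
           (cong₂ _++_ (map∘map (cr-vertex k) (allFin (n G))) (map∘map (cr-edge k) (allFin (m G)))))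

initialColour : ∀ k → GColour k → ℕ
initialColour zero    c = c
initialColour (suc k) c = initialColour k (proj₁ c)

initialColour-cong : ∀ k {c d} → c ≈[ GCol k ] d → initialColour k c ≡ initialColour k d
initialColour-cong zero    c≡d = c≡d
initialColour-cong (suc k) c≈d = initialColour-cong k (proj₁ c≈d)

module _ (G : Hypergraph) where

  initialColour-crᵛ : ∀ k v → initialColour k (crᵛ G k v) ≡ 1
  initialColour-crᵛ zero    v = refl
  initialColour-crᵛ (suc k) v = initialColour-crᵛ k v

  initialColour-crᵉ : ∀ k e → initialColour k (crᵉ G k e) ≡ 2
  initialColour-crᵉ zero    e = refl
  initialColour-crᵉ (suc k) e = initialColour-crᵉ k e

  filter-vertexColours : ∀ k →
    filter (λ c → initialColour k c ℕ.≟ 1) (crHist (C G) k) ≡ map (crᵛ G k) (allFin (n G))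
  filter-vertexColours k = begin
    filter IsVertex? (crHist (C G) k)
      ≡⟨ cong (filter IsVertex?) (crHist-C G k) ⟩
    filter IsVertex? (map (crᵛ G k) (allFin (n G)) ++ map (crᵉ G k) (allFin (m G)))
      ≡⟨ List.filter-++ IsVertex? (map (crᵛ G k) (allFin (n G))) (map (crᵉ G k) (allFin (m G))) ⟩
    filter IsVertex? (map (crᵛ G k) (allFin (n G))) ++ filter IsVertex? (map (crᵉ G k) (allFin (m G)))
      ≡⟨ cong₂ _++_
           (List.filter-all IsVertex? (Allₚ.map⁺ (All.universal (initialColour-crᵛ k) (allFin (n G)))))
           (List.filter-none IsVertex? (Allₚ.map⁺ (All.universal edge-not-vertex (allFin (m G))))) ⟩
    map (crᵛ G k) (allFin (n G)) ++ []
      ≡⟨ List.++-identityʳ _ ⟩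
    map (crᵛ G k) (allFin (n G)) ∎
    where
    open ≡-Reasoning
    IsVertex? = λ c → initialColour k c ℕ.≟ 1
    edge-not-vertex : ∀ e → initialColour k (crᵉ G k e) ≢ 1
    edge-not-vertex e eq with () ← trans (sym (initialColour-crᵉ k e)) eq

edgeColour : ∀ k → List (GColour k) → GColour k
edgeColour zero    _ = 2
edgeColour (suc k) L = edgeColour k (map proj₁ L) , map proj₁ L

edgeColour-cong : ∀ k {L L′} → L ≈[ MSet (GCol k) ] L′ → edgeColour k L ≈[ GCol k ] edgeColour k L′
edgeColour-cong zero    _    = refl
edgeColour-cong (suc k) L↭L′ = edgeColour-cong k proj₁-L↭L′ , proj₁-L↭L′
  where proj₁-L↭L′ = Permutationₚ.map⁺ (GCol (suc k)) (GCol k) proj₁ L↭L′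

crᵉ-edgeColour : ∀ G k e → crᵉ G k e ≡ edgeColour k (map (crᵛ G k) (members G e))
crᵉ-edgeColour G zero    e = refl
crᵉ-edgeColour G (suc k) e =
  cong₂ _,_ (trans (crᵉ-edgeColour G k e) (cong (edgeColour k) (sym members-colours)))
            (sym members-colours)
  where
  members-colours : map proj₁ (map (crᵛ G (suc k)) (members G e)) ≡ map (crᵛ G k) (members G e)
  members-colours = map∘map (λ _ → refl) (members G e)

-- 2 * i, by recursion on i so that GCol (double (suc i)) unfolds to two more pair layers.
double : ℕ → ℕ
double zero    = zero
double (suc i) = suc (suc (double i))

n≤′double : ∀ n → n ≤′ double n
n≤′double zero    = z≤′n
n≤′double (suc n) = s≤′s (≤′-step (n≤′double n))

fromIncidence : ∀ i → GColour (double i) → HColour i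
fromIncidence zero    _ = 1
fromIncidence (suc i) c = map (λ d → map (fromIncidence i) (proj₂ d)) (proj₂ c)

fromIncidence-cong : ∀ i {c d} → c ≈[ GCol (double i) ] d → fromIncidence i c ≈[ HCol i ] fromIncidence i d
fromIncidence-cong zero    _   = refl
fromIncidence-cong (suc i) c≈d = Permutationₚ.map⁺ (GCol (suc (double i))) (MSet (HCol i))
  (λ c′≈d′ → Permutationₚ.map⁺ (GCol (double i)) (HCol i) (fromIncidence-cong i) (proj₂ c′≈d′))
  (proj₂ c≈d)

fromIncidence-crᵛ : ∀ G i v → fromIncidence i (crᵛ G (double i) v) ≈[ HCol i ] hcr G i v
fromIncidence-crᵛ G zero    v = refl
fromIncidence-crᵛ G (suc i) v = Multiset.map∘map-↭ (MSet (HCol i))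
  (λ e → Multiset.map∘map-↭ (HCol i) (fromIncidence-crᵛ G i) (members G e)) (edgesAt G v)

coarsen : ∀ i → HColour (suc i) → HColour i
coarsen zero    _ = 1
coarsen (suc i) x = map (map (coarsen i)) x

coarsen-cong : ∀ i {x y} → x ≈[ HCol (suc i) ] y → coarsen i x ≈[ HCol i ] coarsen i y
coarsen-cong zero    _   = refl
coarsen-cong (suc i) x↭y = Permutationₚ.map⁺ (MSet (HCol (suc i))) (MSet (HCol i))
  (Permutationₚ.map⁺ (HCol (suc i)) (HCol i) (coarsen-cong i)) x↭y

coarsen-hcr : ∀ G i v → coarsen i (hcr G (suc i) v) ≈[ HCol i ] hcr G i v
coarsen-hcr G zero    v = refl
coarsen-hcr G (suc i) v = Multiset.map∘map-↭ (MSet (HCol i))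
  (λ e → Multiset.map∘map-↭ (HCol i) (coarsen-hcr G i) (members G e)) (edgesAt G v)

-- Mirrors crᵛ (2i+2) v = ((crᵛ 2i v , {{crᵉ 2i e}}) , {{(crᵉ 2i e , {{crᵛ 2i u : u ∈ e}})}}),
-- the multisets ranging over the edges e at v.
mutual
  toIncidence : ∀ i → HColour i → GColour (double i)
  toIncidence zero    _ = 1
  toIncidence (suc i) x =
    (toIncidence i (coarsen i x) , map (toIncidenceᵉ i) x) ,
    map (λ L → toIncidenceᵉ i L , map (toIncidence i) L) x

  toIncidenceᵉ : ∀ i → List (HColour i) → GColour (double i)
  toIncidenceᵉ i L = edgeColour (double i) (map (toIncidence i) L)

mutual
  toIncidence-cong : ∀ i {x y} → x ≈[ HCol i ] y → toIncidence i x ≈[ GCol (double i) ] toIncidence i y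
  toIncidence-cong zero    _   = refl
  toIncidence-cong (suc i) x↭y =
    (toIncidence-cong i (coarsen-cong i x↭y) ,
     Permutationₚ.map⁺ (MSet (HCol i)) (GCol (double i)) (toIncidenceᵉ-cong i) x↭y) ,
    Permutationₚ.map⁺ (MSet (HCol i)) (GCol (suc (double i)))
      (λ L↭L′ → toIncidenceᵉ-cong i L↭L′ , map-toIncidence-cong i L↭L′) x↭y

  toIncidenceᵉ-cong : ∀ i {L L′} → L ≈[ MSet (HCol i) ] L′ →
                      toIncidenceᵉ i L ≈[ GCol (double i) ] toIncidenceᵉ i L′
  toIncidenceᵉ-cong i L↭L′ = edgeColour-cong (double i) (map-toIncidence-cong i L↭L′)

  map-toIncidence-cong : ∀ i {L L′} → L ≈[ MSet (HCol i) ] L′ →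
                         map (toIncidence i) L ≈[ MSet (GCol (double i)) ] map (toIncidence i) L′
  map-toIncidence-cong i = Permutationₚ.map⁺ (HCol i) (GCol (double i)) (toIncidence-cong i)

module _ (G : Hypergraph) where

  mutual
    toIncidence-hcr : ∀ i v → toIncidence i (hcr G i v) ≈[ GCol (double i) ] crᵛ G (double i) v
    toIncidence-hcr zero    v = refl
    toIncidence-hcr (suc i) v =
      (Setoid.trans (GCol (double i)) (toIncidence-cong i (coarsen-hcr G i v)) (toIncidence-hcr i v) ,
       Multiset.map∘map-↭ (GCol (double i)) (toIncidenceᵉ-members i) (edgesAt G v)) ,
      Multiset.map∘map-↭ (GCol (suc (double i)))
        (λ e → toIncidenceᵉ-members i e , toIncidence-members i e) (edgesAt G v)

    toIncidence-members : ∀ i e → map (toIncidence i) (map (hcr G i) (members G e))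
                                  ≈[ MSet (GCol (double i)) ] map (crᵛ G (double i)) (members G e)
    toIncidence-members i e = Multiset.map∘map-↭ (GCol (double i)) (toIncidence-hcr i) (members G e)

    toIncidenceᵉ-members : ∀ i e → toIncidenceᵉ i (map (hcr G i) (members G e))
                                   ≈[ GCol (double i) ] crᵉ G (double i) e
    toIncidenceᵉ-members i e = Setoid.trans (GCol (double i))
      (edgeColour-cong (double i) (toIncidence-members i e))
      (Setoid.reflexive (GCol (double i)) (sym (crᵉ-edgeColour G (double i) e)))

edgeHist : (G : Hypergraph) (i : ℕ) → List (List (HColour i))
edgeHist G i = map (λ e → map (hcr G i) (members G e)) (allFin (m G))

module _ (G : Hypergraph) (i : ℕ) where
  open Multiset (MSet (HCol i)) using (replicateEach; incidence-double-count)

  concat-hcrHist-suc : concat (hcrHist G (suc i)) ≈[ MSet (MSet (HCol i)) ] replicateEach length (edgeHist G i)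
  concat-hcrHist-suc = begin
    concat (hcrHist G (suc i))
      ↭⟨ incidence-double-count (λ v e → v ∈? f G e) colours (allFin (n G)) (allFin (m G)) ⟩
    concatMap (λ e → replicate (length (members G e)) (colours e)) (allFin (m G))
      ≡⟨ List.concatMap-cong (λ e → cong (λ ℓ → replicate ℓ (colours e))
                                         (sym (List.length-map (hcr G i) (members G e))))
                             (allFin (m G)) ⟩
    concatMap (λ e → replicate (length (colours e)) (colours e)) (allFin (m G))
      ≡⟨ List.concatMap-map (λ L → replicate (length L) L) colours (allFin (m G)) ⟨
    replicateEach length (edgeHist G i) ∎
    where
    open Permutation (MSet (HCol i)) using (module PermutationReasoning)
    open PermutationReasoning
    colours = λ e → map (hcr G i) (members G e)

  edgeHist-nonempty : All (λ L → 0 < length L) (edgeHist G i)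
  edgeHist-nonempty = Allₚ.map⁺ (All.universal nonempty (allFin (m G)))
    where
    nonempty : ∀ e → 0 < length (map (hcr G i) (members G e))
    nonempty e with u , u∈e ← f≠∅ G e rewrite List.length-map (hcr G i) (members G e) =
      List.filter-some (λ u → u ∈? f G e) (lose (∈-allFin u) u∈e)

module _ (G H : Hypergraph) (i : ℕ) where

  edgeHist-≈ : hcrHist G (suc i) ≈[ MSet (HCol (suc i)) ] hcrHist H (suc i) →
               edgeHist G i ≈[ MSet (MSet (HCol i)) ] edgeHist H i
  edgeHist-≈ p = replicateEach-cancel (Permutationₚ.xs↭ys⇒|xs|≡|ys| (HCol i))
    (edgeHist-nonempty G i) (edgeHist-nonempty H i)
    (↭-trans (↭-sym (concat-hcrHist-suc G i)) (↭-trans (concat⁺ p) (concat-hcrHist-suc H i)))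
    where
    open Multiset (MSet (HCol i)) using (replicateEach-cancel; concat⁺)
    open Permutation (MSet (HCol i)) using (↭-trans; ↭-sym)

  crHist-≈-from-hcrHist : hcrHist G i ≈[ MSet (HCol i) ] hcrHist H i →
                          hcrHist G (suc i) ≈[ MSet (HCol (suc i)) ] hcrHist H (suc i) →
                          crHist (C G) (double i) ≈[ MSet (GCol (double i)) ] crHist (C H) (double i)
  crHist-≈-from-hcrHist p q = begin
    crHist (C G) (double i)
      ≡⟨ crHist-C G (double i) ⟩
    map (crᵛ G (double i)) (allFin (n G)) ++ map (crᵉ G (double i)) (allFin (m G))
      ↭⟨ ++⁺ (map⁺-via (HCol i) (GCol (double i)) (toIncidence i) (toIncidence-cong i)
                 (toIncidence-hcr G i) (toIncidence-hcr H i) p)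
             (map⁺-via (MSet (HCol i)) (GCol (double i)) (toIncidenceᵉ i) (toIncidenceᵉ-cong i)
                 (toIncidenceᵉ-members G i) (toIncidenceᵉ-members H i) (edgeHist-≈ q)) ⟩
    map (crᵛ H (double i)) (allFin (n H)) ++ map (crᵉ H (double i)) (allFin (m H))
      ≡⟨ crHist-C H (double i) ⟨
    crHist (C H) (double i) ∎
    where
    open Permutation (GCol (double i)) using (module PermutationReasoning)
    open Permutationₚ (GCol (double i)) using (++⁺)
    open PermutationReasoning

  hcrHist-≈-from-crHist : crHist (C G) (double i) ≈[ MSet (GCol (double i)) ] crHist (C H) (double i) →
                          hcrHist G i ≈[ MSet (HCol i) ] hcrHist H i
  hcrHist-≈-from-crHist p = map⁺-via (GCol (double i)) (HCol i) (fromIncidence i) (fromIncidence-cong i)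
    (fromIncidence-crᵛ G i) (fromIncidence-crᵛ H i)
    (subst₂ (Eq (MSet (GCol (double i))))
      (filter-vertexColours G (double i)) (filter-vertexColours H (double i))
      (Permutationₚ.filter⁺ (GCol (double i)) IsVertex? IsVertex-resp p))
    where
    IsVertex? = λ c → initialColour (double i) c ℕ.≟ 1
    IsVertex-resp : ∀ {c d} → c ≈[ GCol (double i) ] d →
                    initialColour (double i) c ≡ 1 → initialColour (double i) d ≡ 1
    IsVertex-resp c≈d = trans (sym (initialColour-cong (double i) c≈d))

module _ (X Y : ColGraph) where

  crHist-≈-pred : ∀ k → crHist X (suc k) ≈[ MSet (GCol (suc k)) ] crHist Y (suc k) →
                  crHist X k ≈[ MSet (GCol k) ] crHist Y k
  crHist-≈-pred k = map⁺-via (GCol (suc k)) (GCol k) proj₁ proj₁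
    (λ _ → Setoid.refl (GCol k)) (λ _ → Setoid.refl (GCol k))

  crHist-≈-antitone : ∀ {j k} → j ≤′ k → crHist X k ≈[ MSet (GCol k) ] crHist Y k →
                      crHist X j ≈[ MSet (GCol j) ] crHist Y j
  crHist-≈-antitone ≤′-refl                    p = p
  crHist-≈-antitone {k = suc k} (≤′-step j≤′k) p = crHist-≈-antitone j≤′k (crHist-≈-pred k p)

lemma2 : (G H : Hypergraph) → (¬ HDistinguishes G H) ⇔ (¬ GDistinguishes (C G) (C H))
lemma2 G H = mk⇔
  (λ ¬dist (k , ≉ₖ) → ¬dist (k , λ ≈ₖ → ¬dist (suc k , λ ≈ₖ₊₁ →
     ≉ₖ (crHist-≈-antitone (C G) (C H) (n≤′double k) (crHist-≈-from-hcrHist G H k ≈ₖ ≈ₖ₊₁)))))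
  (λ ¬dist (i , ≉ᵢ) → ¬dist (double i , ≉ᵢ ∘ hcrHist-≈-from-crHist G H i))
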